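{- Let $n,d,p$ be integers with $0\le d<n$ and $0\le p\le n-d$, and let $\tau\in\bar{\mathcal{S}}_p(n,d)$ with $+$-component decomposition $\Delta(\tau)=(\tau_0,\dots,\tau_d)$. Then for every $i\in[0,d]$, $\tau_i$ is a co-signotope in $\bar{\mathcal{S}}_{|\mathcal{C}^\tau_i|,i}(n,d)$.
   Context: $[a,b]=\{x\in\mathbb{Z}:a\le x\le b\}$, $[n]=[1,n]$. A $d$-subset of $[n]$ is written as its increasing tuple $B=(b_1,\dots,b_d)$. For a function $f$ on $d$-subsets of $[n]$, a $d$-subset $B$ and $j\in[d]$, let $B_j=B\setminus\{b_j\}$ and $[n]\setminus B_j=\{x_1<\dots<x_{n-d+1}\}$; the $(f,B,j)$-series is $(f(B_j\cup\{x_1\}),\dots,f(B_j\cup\{x_{n-d+1}\}))$, and for $f$ the identity it is called the $(B,j)$-series. For $0\le d<n$, a $d$-co-signotope on $n$ elements is a map $\tau:\binom{[n]}{d}\to\{+,-\}$ such that every $(\tau,B,j)$-series has at most one sign change; $+$-subsets are the $R$ with $\tau(R)=+$; $\bar{\mathcal{S}}_p(n,d)$ is the set of those with exactly $p$ $+$-subsets. The graph $G_{n,d}$ has the $d$-subsets of $[n]$ as vertices, two being adjacent if they are consecutive entries of some $(B,j)$-series; a $+$-component of $\tau$ is a connected component of the subgraph induced by the $+$-subsets. For $i\in[0,d]$, $S_{n,d,i}=\{1,\dots,i\}\cup\{n-d+i+1,\dots,n\}$, $\mathcal{C}^\tau_i$ is the $+$-component containing $S_{n,d,i}$ (empty if $\tau(S_{n,d,i})=-$),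 and $\bar{\mathcal{S}}_{c,i}(n,d)$ is the set of $\tau\in\bar{\mathcal{S}}_c(n,d)$ such that $\mathcal{C}^\tau_i$ is the only non-empty $+$-component. The $+$-component decomposition $\Delta(\tau)$ is the tuple $(\tau_0,\dots,\tau_d)$ of sign functions on $\binom{[n]}{d}$ with $\tau_i^{ -1}(+)=\mathcal{C}^\tau_i$ (as a set of $d$-subsets). -}

module Defs where

open import Data.Nat using (ℕ; zero; suc; _+_; _∸_; _≤_; _<_)
open import Data.Bool using (Bool; true; false)
open import Data.Fin using (Fin; toℕ)
open import Data.Fin.Subset using (Subset; _∪_; _─_; ⁅_⁆; ∣_∣; _∈_)
open import Data.Fin.Subset.Properties using (_∈?_)
open import Data.List using (List; []; _∷_; map; filter; allFin; length)
open import Data.List.Relation.Unary.Unique.Propositional using (Unique)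
import Data.List.Membership.Propositional as LM
open import Data.Vec using (tabulate)
open import Data.Product using (Σ; _×_; ∃)
open import Data.Sum using (_⊎_)
open import Relation.Nullary using (¬?)
open import Relation.Nullary.Decidable using (⌊_⌋)
open import Relation.Binary.PropositionalEquality using (_≡_)
open import Data.Nat using (_≟_)
open import Function.Bundles using (_⇔_)

-- Conventions: the ground set [n] = {1,…,n} is represented by Fin n
-- (element k ↦ k-1, order preserving); a subset of [n] is a
-- 'Subset n' (characteristic Bool-vector); the sign + is 'true',
-- the sign - is 'false'.  A sign function on d-subsets is represented
-- by a total function 'Subset n → Bool'; only its values on d-subsets
-- are ever inspected by the definitions below.

SignFun : ℕ → Set
SignFun n = Subset n → Bool

IsDSubset : ∀ {n} → ℕ → Subset n → Set
IsDSubset d R = ∣ R ∣ ≡ d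

complementList : ∀ {n} → Subset n → List (Fin n)
complementList {n} A = filter (λ x → ¬? (x ∈? A)) (allFin n)

seriesSets : ∀ {n} → Subset n → List (Subset n)
seriesSets A = map (λ x → A ∪ ⁅ x ⁆) (complementList A)

-- (f, B, j)-series, where A = B_j = B \ {b_j}
series : ∀ {n} {X : Set} → (Subset n → X) → Subset n → List X
series f A = map f (seriesSets A)

signChanges : List Bool → ℕ
signChanges [] = 0
signChanges (x ∷ []) = 0
signChanges (true ∷ true ∷ xs) = signChanges (true ∷ xs)
signChanges (false ∷ false ∷ xs) = signChanges (false ∷ xs)
signChanges (true ∷ false ∷ xs) = suc (signChanges (false ∷ xs))
signChanges (false ∷ true ∷ xs) = suc (signChanges (true ∷ xs))

-- d-co-signotope on n elements (the hypothesis 0 ≤ d < n is carried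
-- separately).  "j ∈ [d]" is rendered as "b ∈ B" with b = b_j.
IsCoSignotope : (n d : ℕ) → SignFun n → Set
IsCoSignotope n d τ =
  ∀ (B : Subset n) → IsDSubset d B → ∀ (b : Fin n) → b ∈ B →
  signChanges (series τ (B ─ ⁅ b ⁆)) ≤ 1

HasCard : ∀ {n} → (Subset n → Set) → ℕ → Set
HasCard {n} P c =
  Σ (List (Subset n)) λ xs →
    Unique xs × (∀ S → (S LM.∈ xs) ⇔ P S) × length xs ≡ c

PlusSubset : ∀ {n} → ℕ → SignFun n → Subset n → Set
PlusSubset d τ R = IsDSubset d R × τ R ≡ true

InSbar : (n d p : ℕ) → SignFun n → Set
InSbar n d p τ = IsCoSignotope n d τ × HasCard (PlusSubset d τ) p

data Consecutive {X : Set} (x y : X) : List X → Set where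
  here  : ∀ {xs} → Consecutive x y (x ∷ y ∷ xs)
  there : ∀ {z xs} → Consecutive x y xs → Consecutive x y (z ∷ xs)

Adjacent : (n d : ℕ) → Subset n → Subset n → Set
Adjacent n d R R' =
  ∃ λ (B : Subset n) → IsDSubset d B × ∃ λ (b : Fin n) → b ∈ B ×
    (Consecutive R R' (seriesSets (B ─ ⁅ b ⁆)) ⊎
     Consecutive R' R (seriesSets (B ─ ⁅ b ⁆)))

-- walks in the subgraph of G_{n,d} induced by the +-subsets of τ,
-- starting at a +-subset S (the start vertex is assumed + separately)
data PlusPath (n d : ℕ) (τ : SignFun n) : Subset n → Subset n → Set where
  stop : ∀ {S} → PlusPath n d τ S S
  step : ∀ {S T U} → Adjacent n d S T → τ T ≡ true →
         PlusPath n d τ T U → PlusPath n d τ S U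

-- S_{n,d,i} = {1,…,i} ∪ {n-d+i+1,…,n}  (shifted to Fin n)
Sndi : (n d i : ℕ) → Subset n
Sndi n d i = tabulate λ x → ⌊ suc (toℕ x) ≤? i ⌋ ∨' ⌊ (n ∸ d) + i ≤? toℕ x ⌋
  where
  open import Data.Nat using (_≤?_)
  open import Data.Bool using () renaming (_∨_ to _∨'_)

-- membership of R in the +-component C^τ_i (empty if τ(S_{n,d,i}) = -)
InComponent : (n d : ℕ) → SignFun n → ℕ → Subset n → Set
InComponent n d τ i R =
  τ (Sndi n d i) ≡ true × PlusPath n d τ (Sndi n d i) R

-- τ ∈ S̄_{c,i}(n,d): τ ∈ S̄_c(n,d) and C^τ_i is the only non-empty
-- +-component, i.e. every +-subset of τ lies in C^τ_i
InSbarCI : (n d c i : ℕ) → SignFun n → Set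
InSbarCI n d c i τ =
  InSbar n d c τ × (∀ R → PlusSubset d τ R → InComponent n d τ i R)

-- τ' is the i-th entry τ_i of the +-component decomposition Δ(τ):
-- τ'^{-1}(+) = C^τ_i as sets of d-subsets
IsDeltaComponent : (n d : ℕ) → SignFun n → ℕ → SignFun n → Set
IsDeltaComponent n d τ i τ' =
  ∀ R → IsDSubset d R → (τ' R ≡ true ⇔ InComponent n d τ i R)

{-# OPTIONS --safe #-}

-- The +-subsets of τ_i are by definition the component C^τ_i, so the cardinality claim is
-- immediate, and C^{τ_i}_i = C^τ_i because every τ-path inside C^τ_i is a τ_i-path.  For the
-- co-signotope property compare τ_i with τ along a series: τ_i is + only where τ is, and two
-- consecutive entries that are both + for τ are adjacent in G_{n,d}, hence lie in the same
-- +-component and get the same sign under τ_i.  So every sign change of τ_i is one of τ.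

module Submission where

open import Defs
open import Data.Nat using (ℕ; _≤_; _<_; _∸_; zero; suc; _+_; z≤n; s≤s; _≤?_)
open import Data.Nat.Properties
  using (≤-refl; ≤-trans; <⇒≤; <⇒≱; +-mono-≤; +-monoʳ-≤; m≤n+m; ∸-+-assoc; m∸[m∸n]≡n; m+[n∸m]≡n;
         m∸n+n≡m; ≤-reflexive; module ≤-Reasoning)
open import Data.Bool using (Bool; true; false; _∨_)
open import Data.Bool.Properties using (∨-zeroʳ)
open import Data.Fin using (Fin; toℕ; zero; suc)
open import Data.Fin.Subset using (Subset; _∪_; _─_; ⁅_⁆; ∣_∣; _∈_; _∉_; inside; outside)
open import Data.Fin.Subset.Properties using (p─⊥≡p; ∪-identityʳ; _∈?_)
open import Data.Vec using (_∷_; here; there; tabulate)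
open import Data.List using (List; []; _∷_; map; allFin)
import Data.List.Membership.Propositional as List
open import Data.List.Membership.Propositional.Properties using (∈-map⁻; ∈-filter⁻)
open import Data.List.Relation.Unary.Any using (here; there)
open import Data.Product using (_×_; _,_; proj₁; proj₂)
open import Data.Sum using (inj₁; inj₂)
open import Function using (_∘_)
open import Function.Bundles using (_⇔_; mk⇔; Equivalence)
open import Function.Construct.Composition using (_⇔-∘_)
open import Relation.Nullary using (¬?; contradiction)
open import Relation.Nullary.Decidable using (⌊_⌋; isYes≗does; dec-true; dec-false)
open import Relation.Binary.PropositionalEquality
  using (_≡_; refl; sym; trans; cong; cong₂; module ≡-Reasoning)

x∈p⇒suc∣p─⁅x⁆∣≡∣p∣ : ∀ {n} {p : Subset n} {x : Fin n} → x ∈ p → suc ∣ p ─ ⁅ x ⁆ ∣ ≡ ∣ p ∣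
x∈p⇒suc∣p─⁅x⁆∣≡∣p∣ {p = inside ∷ p}  here        = cong (suc ∘ ∣_∣) (p─⊥≡p p)
x∈p⇒suc∣p─⁅x⁆∣≡∣p∣ {p = inside ∷ p}  (there x∈p) = cong suc (x∈p⇒suc∣p─⁅x⁆∣≡∣p∣ x∈p)
x∈p⇒suc∣p─⁅x⁆∣≡∣p∣ {p = outside ∷ p} (there x∈p) = x∈p⇒suc∣p─⁅x⁆∣≡∣p∣ x∈p

x∉p⇒∣p∪⁅x⁆∣≡suc∣p∣ : ∀ {n} {p : Subset n} {x : Fin n} → x ∉ p → ∣ p ∪ ⁅ x ⁆ ∣ ≡ suc ∣ p ∣
x∉p⇒∣p∪⁅x⁆∣≡suc∣p∣ {p = outside ∷ p} {zero}  _   = cong (suc ∘ ∣_∣) (∪-identityʳ p)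
x∉p⇒∣p∪⁅x⁆∣≡suc∣p∣ {p = inside ∷ p}  {zero}  x∉p = contradiction here x∉p
x∉p⇒∣p∪⁅x⁆∣≡suc∣p∣ {p = inside ∷ p}  {suc x} x∉p = cong suc (x∉p⇒∣p∪⁅x⁆∣≡suc∣p∣ (x∉p ∘ there))
x∉p⇒∣p∪⁅x⁆∣≡suc∣p∣ {p = outside ∷ p} {suc x} x∉p = x∉p⇒∣p∪⁅x⁆∣≡suc∣p∣ (x∉p ∘ there)

∣tabulate∣-gap : ∀ n (g : ℕ → Bool) {i m} → i ≤ m → m ≤ n →
  (∀ {k} → k < i → g k ≡ true) →
  (∀ {k} → i ≤ k → k < m → g k ≡ false) →
  (∀ {k} → m ≤ k → g k ≡ true) →
  ∣ tabulate {n = n} (g ∘ toℕ) ∣ ≡ i + (n ∸ m)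
∣tabulate∣-gap zero    g z≤n z≤n _ _ _ = refl
∣tabulate∣-gap (suc n) g {suc i} {suc m} (s≤s i≤m) (s≤s m≤n) below gap above
  rewrite below {0} (s≤s z≤n) =
  cong suc (∣tabulate∣-gap n (g ∘ suc) i≤m m≤n
    (below ∘ s≤s) (λ i≤k k<m → gap (s≤s i≤k) (s≤s k<m)) (above ∘ s≤s))
∣tabulate∣-gap (suc n) g {zero} {suc m} z≤n (s≤s m≤n) _ gap above
  rewrite gap {0} z≤n (s≤s z≤n) =
  ∣tabulate∣-gap n (g ∘ suc) z≤n m≤n
    (λ ()) (λ _ k<m → gap z≤n (s≤s k<m)) (above ∘ s≤s)
∣tabulate∣-gap (suc n) g {zero} {zero} z≤n z≤n _ _ above
  rewrite above {0} z≤n =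
  cong suc (∣tabulate∣-gap n (g ∘ suc) z≤n z≤n (λ ()) (λ _ ()) (λ _ → above z≤n))

∣Sndi∣≡d : ∀ {n d i} → i ≤ d → d ≤ n → IsDSubset d (Sndi n d i)
∣Sndi∣≡d {n} {d} {i} i≤d d≤n =
  trans (∣tabulate∣-gap n g (m≤n+m i (n ∸ d)) m≤n below gap above) i+[n∸m]≡d
  where
  m : ℕ
  m = n ∸ d + i
  g : ℕ → Bool
  g k = ⌊ suc k ≤? i ⌋ ∨ ⌊ m ≤? k ⌋
  isYes-≤? : ∀ {a b} → a ≤ b → ⌊ a ≤? b ⌋ ≡ true
  isYes-≤? {a} {b} a≤b = trans (isYes≗does (a ≤? b)) (dec-true (a ≤? b) a≤b)
  isNo-≤? : ∀ {a b} → b < a → ⌊ a ≤? b ⌋ ≡ false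
  isNo-≤? {a} {b} b<a = trans (isYes≗does (a ≤? b)) (dec-false (a ≤? b) (<⇒≱ b<a))
  below : ∀ {k} → k < i → g k ≡ true
  below {k} k<i = cong (_∨ ⌊ m ≤? k ⌋) (isYes-≤? k<i)
  gap : ∀ {k} → i ≤ k → k < m → g k ≡ false
  gap i≤k k<m = cong₂ _∨_ (isNo-≤? (s≤s i≤k)) (isNo-≤? k<m)
  above : ∀ {k} → m ≤ k → g k ≡ true
  above {k} m≤k = trans (cong (⌊ suc k ≤? i ⌋ ∨_) (isYes-≤? m≤k)) (∨-zeroʳ _)
  m≤n : m ≤ n
  m≤n = ≤-trans (+-monoʳ-≤ (n ∸ d) i≤d) (≤-reflexive (m∸n+n≡m d≤n))
  i+[n∸m]≡d : i + (n ∸ m) ≡ d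
  i+[n∸m]≡d = begin
    i + (n ∸ (n ∸ d + i))  ≡⟨ cong (i +_) (∸-+-assoc n (n ∸ d) i) ⟨
    i + (n ∸ (n ∸ d) ∸ i)  ≡⟨ cong (λ x → i + (x ∸ i)) (m∸[m∸n]≡n d≤n) ⟩
    i + (d ∸ i)            ≡⟨ m+[n∸m]≡n i≤d ⟩
    d                      ∎
    where open ≡-Reasoning

seriesSets-IsDSubset : ∀ {n d} {B : Subset n} {b : Fin n} → IsDSubset d B → b ∈ B →
  ∀ {S} → S List.∈ seriesSets (B ─ ⁅ b ⁆) → IsDSubset d S
seriesSets-IsDSubset {B = B} {b} ∣B∣≡d b∈B S∈series
  with ∈-map⁻ (λ x → (B ─ ⁅ b ⁆) ∪ ⁅ x ⁆) S∈series
... | x , x∈complement , refl =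
  trans (x∉p⇒∣p∪⁅x⁆∣≡suc∣p∣ x∉B─b) (trans (x∈p⇒suc∣p─⁅x⁆∣≡∣p∣ b∈B) ∣B∣≡d)
  where
  x∉B─b : x ∉ B ─ ⁅ b ⁆
  x∉B─b = proj₂ (∈-filter⁻ (λ y → ¬? (y ∈? (B ─ ⁅ b ⁆))) {xs = allFin _} x∈complement)

Consecutive⇒∈ : ∀ {X : Set} {x y : X} {xs : List X} → Consecutive x y xs → x List.∈ xs × y List.∈ xs
Consecutive⇒∈ here      = here refl , there (here refl)
Consecutive⇒∈ (there c) = let x∈ , y∈ = Consecutive⇒∈ c in there x∈ , there y∈

Adjacent-sym : ∀ {n d} {R T : Subset n} → Adjacent n d R T → Adjacent n d T R
Adjacent-sym (B , ∣B∣≡d , b , b∈B , inj₁ c) = B , ∣B∣≡d , b , b∈B , inj₂ c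
Adjacent-sym (B , ∣B∣≡d , b , b∈B , inj₂ c) = B , ∣B∣≡d , b , b∈B , inj₁ c

Adjacent⇒IsDSubset : ∀ {n d} {R T : Subset n} → Adjacent n d R T → IsDSubset d T
Adjacent⇒IsDSubset (B , ∣B∣≡d , b , b∈B , inj₁ c) = seriesSets-IsDSubset ∣B∣≡d b∈B (proj₂ (Consecutive⇒∈ c))
Adjacent⇒IsDSubset (B , ∣B∣≡d , b , b∈B , inj₂ c) = seriesSets-IsDSubset ∣B∣≡d b∈B (proj₁ (Consecutive⇒∈ c))

PlusPath-IsDSubset : ∀ {n d τ} {S R : Subset n} → PlusPath n d τ S R → IsDSubset d S → IsDSubset d R
PlusPath-IsDSubset stop         ∣S∣≡d = ∣S∣≡d
PlusPath-IsDSubset (step a _ p) _     = PlusPath-IsDSubset p (Adjacent⇒IsDSubset a)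

PlusPath-plus : ∀ {n d τ} {S R : Subset n} → PlusPath n d τ S R → τ S ≡ true → τ R ≡ true
PlusPath-plus stop          τS = τS
PlusPath-plus (step _ τT p) _  = PlusPath-plus p τT

PlusPath-snoc : ∀ {n d τ} {S U V : Subset n} →
  PlusPath n d τ S U → Adjacent n d U V → τ V ≡ true → PlusPath n d τ S V
PlusPath-snoc stop           a τV = step a τV stop
PlusPath-snoc (step a′ τT p) a τV = step a′ τT (PlusPath-snoc p a τV)

InComponent-plus : ∀ {n d τ i} {R : Subset n} → InComponent n d τ i R → τ R ≡ true
InComponent-plus (τS , p) = PlusPath-plus p τS

InComponent-step : ∀ {n d τ i} {R T : Subset n} →
  InComponent n d τ i R → Adjacent n d R T → τ T ≡ true → InComponent n d τ i T
InComponent-step (τS , p) a τT = τS , PlusPath-snoc p a τT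

HasCard-cong : ∀ {n} {P Q : Subset n → Set} {c} → (∀ S → P S ⇔ Q S) → HasCard P c → HasCard Q c
HasCard-cong P⇔Q (xs , unique , ∈⇔P , length≡c) =
  xs , unique , (λ S → P⇔Q S ⇔-∘ ∈⇔P S) , length≡c

signChange : Bool → Bool → ℕ
signChange true  true  = 0
signChange false false = 0
signChange true  false = 1
signChange false true  = 1

signChanges-∷∷ : ∀ a b l → signChanges (a ∷ b ∷ l) ≡ signChange a b + signChanges (b ∷ l)
signChanges-∷∷ true  true  l = refl
signChanges-∷∷ false false l = refl
signChanges-∷∷ true  false l = refl
signChanges-∷∷ false true  l = refl

signChange-self : ∀ a → signChange a a ≡ 0
signChange-self true  = refl
signChange-self false = refl

signChange≤1 : ∀ a b → signChange a b ≤ 1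
signChange≤1 true  true  = z≤n
signChange≤1 false false = z≤n
signChange≤1 true  false = ≤-refl
signChange≤1 false true  = ≤-refl

signChange-mono : ∀ {a b a′ b′} → (a′ ≡ true → a ≡ true) → (b′ ≡ true → b ≡ true) →
  (a ≡ true → b ≡ true → a′ ≡ b′) → signChange a′ b′ ≤ signChange a b
signChange-mono {true}  {true}  {a′} {b′} _ _ same =
  ≤-reflexive (trans (cong (λ x → signChange x b′) (same refl refl)) (signChange-self b′))
signChange-mono {true}  {false} _ _ _ = signChange≤1 _ _
signChange-mono {false} {true}  _ _ _ = signChange≤1 _ _
signChange-mono {false} {false} {false} {false} _  _  _ = z≤n
signChange-mono {false} {false} {true}          a′⇒a _ _ = contradiction (a′⇒a refl) λ ()
signChange-mono {false} {false} {false} {true}  _ b′⇒b _ = contradiction (b′⇒b refl) λ ()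

signChanges-map-mono : ∀ {X : Set} (f g : X → Bool) (xs : List X) →
  (∀ {x} → x List.∈ xs → g x ≡ true → f x ≡ true) →
  (∀ {x y} → Consecutive x y xs → f x ≡ true → f y ≡ true → g x ≡ g y) →
  signChanges (map g xs) ≤ signChanges (map f xs)
signChanges-map-mono f g []          _   _     = z≤n
signChanges-map-mono f g (x ∷ [])    _   _     = z≤n
signChanges-map-mono f g (x ∷ y ∷ r) g⇒f const = begin
  signChanges (g x ∷ g y ∷ map g r)               ≡⟨ signChanges-∷∷ (g x) (g y) (map g r) ⟩
  signChange (g x) (g y) + signChanges (map g (y ∷ r))
    ≤⟨ +-mono-≤ (signChange-mono (g⇒f (here refl)) (g⇒f (there (here refl))) (const here))
                (signChanges-map-mono f g (y ∷ r) (g⇒f ∘ there) (const ∘ there)) ⟩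
  signChange (f x) (f y) + signChanges (map f (y ∷ r)) ≡⟨ signChanges-∷∷ (f x) (f y) (map f r) ⟨
  signChanges (f x ∷ f y ∷ map f r)               ∎
  where open ≤-Reasoning

true⇔true⇒≡ : ∀ {a b : Bool} → (a ≡ true → b ≡ true) → (b ≡ true → a ≡ true) → a ≡ b
true⇔true⇒≡ {true}  a⇒b _   = sym (a⇒b refl)
true⇔true⇒≡ {false} {false} _ _   = refl
true⇔true⇒≡ {false} {true}  _ b⇒a = b⇒a refl

IsCoSignotope-restrict : ∀ {n d} {τ σ : SignFun n} → IsCoSignotope n d τ →
  (∀ {R} → IsDSubset d R → σ R ≡ true → τ R ≡ true) →
  (∀ {R T} → Adjacent n d R T → τ R ≡ true → τ T ≡ true → σ R ≡ σ T) →
  IsCoSignotope n d σ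
IsCoSignotope-restrict {τ = τ} {σ} cosig σ⇒τ σ-const B ∣B∣≡d b b∈B =
  ≤-trans (signChanges-map-mono τ σ (seriesSets (B ─ ⁅ b ⁆))
             (σ⇒τ ∘ seriesSets-IsDSubset ∣B∣≡d b∈B)
             (λ c → σ-const (B , ∣B∣≡d , b , b∈B , inj₁ c)))
          (cosig B ∣B∣≡d b b∈B)

module Decomposition {n d i : ℕ} (i≤d : i ≤ d) (d≤n : d ≤ n) {τ τi : SignFun n}
                     (Δ : IsDeltaComponent n d τ i τi) where

  InComponent⇒IsDSubset : ∀ {R} → InComponent n d τ i R → IsDSubset d R
  InComponent⇒IsDSubset (_ , p) = PlusPath-IsDSubset p (∣Sndi∣≡d i≤d d≤n)

  τi⇒InComponent : ∀ {R} → IsDSubset d R → τi R ≡ true → InComponent n d τ i R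
  τi⇒InComponent ∣R∣≡d = Equivalence.to (Δ _ ∣R∣≡d)

  InComponent⇒τi : ∀ {R} → InComponent n d τ i R → τi R ≡ true
  InComponent⇒τi R∈C = Equivalence.from (Δ _ (InComponent⇒IsDSubset R∈C)) R∈C

  InComponent⇔PlusSubset : ∀ R → InComponent n d τ i R ⇔ PlusSubset d τi R
  InComponent⇔PlusSubset R = mk⇔ (λ R∈C → InComponent⇒IsDSubset R∈C , InComponent⇒τi R∈C)
                                 (λ (∣R∣≡d , τiR) → τi⇒InComponent ∣R∣≡d τiR)

  τi-step : ∀ {R T} → Adjacent n d R T → τ T ≡ true → τi R ≡ true → τi T ≡ true
  τi-step a τT τiR =
    InComponent⇒τi (InComponent-step (τi⇒InComponent (Adjacent⇒IsDSubset (Adjacent-sym a)) τiR) a τT)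

  τi-IsCoSignotope : IsCoSignotope n d τ → IsCoSignotope n d τi
  τi-IsCoSignotope cosig = IsCoSignotope-restrict cosig
    (λ ∣R∣≡d → InComponent-plus ∘ τi⇒InComponent ∣R∣≡d)
    (λ a τR τT → true⇔true⇒≡ (τi-step a τT) (τi-step (Adjacent-sym a) τR))

  PlusPath-τ⇒τi : ∀ {S R} → InComponent n d τ i S → PlusPath n d τ S R → PlusPath n d τi S R
  PlusPath-τ⇒τi _    stop          = stop
  PlusPath-τ⇒τi S∈C (step a τT p) = step a (InComponent⇒τi T∈C) (PlusPath-τ⇒τi T∈C p)
    where T∈C = InComponent-step S∈C a τT

  τi-connected : ∀ R → PlusSubset d τi R → InComponent n d τi i R
  τi-connected R (∣R∣≡d , τiR) with τi⇒InComponent ∣R∣≡d τiR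
  ... | τS , p = InComponent⇒τi S∈C , PlusPath-τ⇒τi S∈C p
    where S∈C = τS , stop

lemma17 : (n d p : ℕ) → d < n → p ≤ n ∸ d →
    (τ : SignFun n) → InSbar n d p τ →
    (i : ℕ) → i ≤ d →
    (τi : SignFun n) → IsDeltaComponent n d τ i τi →
    (c : ℕ) → HasCard (InComponent n d τ i) c →
    InSbarCI n d c i τi
lemma17 n d p d<n _ τ (cosig , _) i i≤d τi Δ c ∣C∣≡c =
  (τi-IsCoSignotope cosig , HasCard-cong InComponent⇔PlusSubset ∣C∣≡c) , τi-connected
  where open Decomposition i≤d (<⇒≤ d<n) Δ
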